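{- Let $u\in L_{\mathrm{up}}$ and $\ell \in F_u$. Then $P_{u,\ell}$ is nonempty and is the edge set of a path.
   Context: Let $G=(V,E)$ be a tree with links $L\subseteq\binom{V}{2}$ (weights irrelevant here), and fix a root $r\in V$. For a link $\ell$, $P_\ell$ is the edge set of the path in $G$ between its endpoints and $V_\ell$ its vertex set. A vertex $z$ is an ancestor of $v$ if $z$ lies on the $r$-$v$ path in $G$ (including $r$ and $v$); $v$ is then a descendant of $z$. $\mathrm{apex}(\ell)$ is the vertex of $V_\ell$ closest to $r$. An up-link is a link $\{t,b\}$ with $t$ an ancestor of $b$; $L_{\mathrm{up}}$ is the set of up-links. Let $F\subseteq L$ satisfy $\bigcup_{\ell\in F}P_\ell=E$. For $v\in V$ let $B_v=\{\ell\in F\colon \mathrm{apex}(\ell)\text{ is a descendant of }v\}$. For $u=\{t,b\}\in L_{\mathrm{up}}$ with $t$ an ancestor of $b$, let $v_u$ be the ancestor of $t$ farthest from $r$ such that $P_u\subseteq\bigcup_{\ell\in B_{v_u}}P_\ell$, and let $F_u\subseteq B_{v_u}$ be a fixed inclusion-wise minimal set with $P_u\subseteq\bigcup_{\ell\in F_u}P_\ell$. For $\ell\in F_u$, $P_{u,\ell}:=P_u\setminus\bigcup_{\bar\ell\in F_u\setminus\{\ell\}}P_{\bar\ell}$. -}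

module Defs where

open import Data.Nat using (ℕ; zero; suc; _≤_)
open import Data.Bool using (Bool; true; false; T)
open import Data.Fin using (Fin)
open import Data.Fin.Subset using (Subset; _⊂_) renaming (_∈_ to _∈ₛ_)
open import Data.List using (List; []; _∷_; _++_; length; head; last)
open import Data.List.Membership.Propositional using (_∈_)
open import Data.List.Relation.Unary.Linked using (Linked)
open import Data.List.Relation.Unary.Unique.Propositional using (Unique)
open import Data.Maybe using (Maybe; just)
open import Data.Product using (Σ; ∃; ∃₂; _×_; _,_; proj₁; proj₂)
open import Data.Sum using (_⊎_)
open import Relation.Binary.PropositionalEquality using (_≡_; _≢_)
open import Relation.Nullary using (¬_)

-- Edges are unordered: {x,y} is an edge iff T (adj x y)
-- (adj is required to be symmetric).  Edge sets are represented by
-- predicates S x y that are read as "{x,y} ∈ S".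

module GraphNotions {n : ℕ} (adj : Fin n → Fin n → Bool) where

  Adj : Fin n → Fin n → Set
  Adj x y = T (adj x y)

  IsPath : List (Fin n) → Set
  IsPath p = Linked Adj p × Unique p × (p ≢ [])

  PathFromTo : Fin n → Fin n → List (Fin n) → Set
  PathFromTo a b p = IsPath p × head p ≡ just a × last p ≡ just b

  Consec : Fin n → Fin n → List (Fin n) → Set
  Consec x y p = ∃₂ λ xs ys → p ≡ xs ++ (x ∷ y ∷ ys)

  EdgeOf : List (Fin n) → Fin n → Fin n → Set
  EdgeOf p x y = Consec x y p ⊎ Consec y x p

  IsCycle : List (Fin n) → Set
  IsCycle p = IsPath p × 3 ≤ length p ×
              ∃₂ λ a b → head p ≡ just a × last p ≡ just b × Adj b a

record TreeWithLinks : Set where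
  field
    n      : ℕ
    adj    : Fin n → Fin n → Bool
  open GraphNotions adj
  field
    adj-sym      : ∀ x y → adj x y ≡ adj y x
    adj-irrefl   : ∀ x → adj x x ≡ false
    connected    : ∀ x y → ∃ λ p → PathFromTo x y p
    acyclic      : ∀ p → ¬ IsCycle p
    root         : Fin n
    m            : ℕ
    ends         : Fin m → Fin n × Fin n
    ends-distinct : ∀ ℓ → proj₁ (ends ℓ) ≢ proj₂ (ends ℓ)
    -- L is a set of unordered pairs (no two links with the same ends)
    ends-inj     : ∀ ℓ ℓ' → (ends ℓ ≡ ends ℓ' ⊎
                             (proj₁ (ends ℓ) ≡ proj₂ (ends ℓ') ×
                              proj₂ (ends ℓ) ≡ proj₁ (ends ℓ'))) → ℓ ≡ ℓ'

module Notions (I : TreeWithLinks) where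
  open TreeWithLinks I public
  open GraphNotions adj public

  Vertex : Set
  Vertex = Fin n

  Link : Set
  Link = Fin m

  EdgeSet : Set₁
  EdgeSet = Vertex → Vertex → Set

  P : Link → EdgeSet
  P ℓ x y = ∃ λ p → PathFromTo (proj₁ (ends ℓ)) (proj₂ (ends ℓ)) p × EdgeOf p x y

  Vtx : Link → Vertex → Set
  Vtx ℓ x = ∃ λ p → PathFromTo (proj₁ (ends ℓ)) (proj₂ (ends ℓ)) p × x ∈ p

  Ancestor : Vertex → Vertex → Set
  Ancestor z v = ∃ λ p → PathFromTo root v p × z ∈ p

  Depth : Vertex → ℕ → Set
  Depth v d = ∃ λ p → PathFromTo root v p × length p ≡ suc d

  IsApex : Link → Vertex → Set
  IsApex ℓ a = Vtx ℓ a ×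
    (∀ w → Vtx ℓ w → ∀ da dw → Depth a da → Depth w dw → da ≤ dw)

  CoveredBy : EdgeSet → (Link → Set) → Set
  CoveredBy S X = ∀ x y → S x y → ∃ λ ℓ → X ℓ × P ℓ x y

  UpLinkWith : Link → Vertex → Vertex → Set
  UpLinkWith u t b = (ends u ≡ (t , b) ⊎ ends u ≡ (b , t)) × Ancestor t b

  module WithF (F : Subset m) where

    B : Vertex → Link → Set
    B v ℓ = ℓ ∈ₛ F × ∃ λ a → IsApex ℓ a × Ancestor v a

    IsVu : Link → Vertex → Vertex → Set
    IsVu u t v = Ancestor v t × CoveredBy (P u) (B v) ×
      (∀ w → Ancestor w t → CoveredBy (P u) (B w) →
         ∀ dw dv → Depth w dw → Depth v dv → dw ≤ dv)

    IsFu : Link → Vertex → Subset m → Set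
    IsFu u v Fu = (∀ ℓ → ℓ ∈ₛ Fu → B v ℓ) ×
                  CoveredBy (P u) (λ ℓ → ℓ ∈ₛ Fu) ×
                  (∀ S → S ⊂ Fu → ¬ CoveredBy (P u) (λ ℓ → ℓ ∈ₛ S))

    Pul : Link → Subset m → Link → EdgeSet
    Pul u Fu ℓ x y = P u x y × (∀ ℓ' → ℓ' ∈ₛ Fu → ℓ' ≢ ℓ → ¬ P ℓ' x y)

  CoversE : Subset m → Set
  CoversE F = ∀ x y → Adj x y → ∃ λ ℓ → ℓ ∈ₛ F × P ℓ x y

{-# OPTIONS --safe #-}
module Submission where

-- The path P_u is covered by the links of F_u, and each P_ℓ meets P_u in a contiguous
-- stretch of edges, because two vertices of a tree are joined by only one path. An edge of P_u
-- covered only by ℓ exists, for otherwise ℓ could be dropped from the minimal cover F_u. The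
-- private edges of ℓ are contiguous along P_u: a link ℓ′ ≠ ℓ covering an edge between two
-- private edges of ℓ avoids both, so its stretch lies inside that of ℓ and ℓ′ could be dropped.
-- A contiguous stretch of the path P_u is itself a path.

open import Defs
open import Data.Bool using (Bool; T)
open import Data.Empty using (⊥; ⊥-elim)
open import Data.Fin as Fin using (Fin)
import Data.Fin.Properties as Fin
open import Data.Fin.Subset using (Subset; _⊂_; _-_) renaming (_∈_ to _∈ₛ_)
open import Data.Fin.Subset.Properties using (_∈?_; x∈p⇒p-x⊂p; x∈p∧x≢y⇒x∈p-y)
open import Data.List using (List; []; _∷_; _++_; _∷ʳ_; [_]; length; head; last; reverse)
open import Data.List.Properties
  using (∷-injectiveʳ; ++-conicalʳ; ++-assoc; unfold-reverse; reverse-++; reverse-involutive; length-reverse)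
open import Data.List.Membership.Propositional using (_∈_; _∉_)
open import Data.List.Membership.Propositional.Properties using (∈-∃++; ∈-++⁻; ∈-++⁺ˡ; ∈-++⁺ʳ)
open import Data.List.Relation.Unary.All as All using (All)
import Data.List.Relation.Unary.All.Properties as All
open import Data.List.Relation.Unary.AllPairs using ([]; _∷_)
open import Data.List.Relation.Unary.Any using (here; there; any?)
import Data.List.Relation.Unary.Any.Properties as Any
import Data.List.Relation.Unary.First as First
import Data.List.Relation.Unary.First.Properties as First
open import Data.List.Relation.Unary.Linked as Linked using (Linked; []; [-]; _∷_)
import Data.List.Relation.Unary.Linked.Properties as Linked
open import Data.List.Relation.Unary.Unique.Propositional using (Unique)
import Data.List.Relation.Unary.Unique.Propositional.Properties as Unique
import Data.List.Relation.Binary.Permutation.Setoid as Perm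
import Data.List.Relation.Binary.Permutation.Setoid.Properties as Perm
open import Data.Maybe using (Maybe; just; nothing)
open import Data.Maybe.Relation.Binary.Connected as Connected using (Connected)
open import Data.Nat using (ℕ; zero; suc; _≤_; z≤n; s≤s; _≤?_)
open import Data.Nat.Properties using (≰⇒≥)
open import Data.Product as Product using (∃; ∃₂; _×_; _,_; proj₁; proj₂)
open import Data.Sum as Sum using (_⊎_; inj₁; inj₂)
open import Function using (_∘_; case_of_; _⇔_; mk⇔; Equivalence)
open import Relation.Binary using (Symmetric)
open import Relation.Binary.PropositionalEquality
  using (_≡_; _≢_; refl; sym; trans; cong; subst; setoid; module ≡-Reasoning)
open import Relation.Nullary using (¬_; Dec; yes; no)
open import Relation.Nullary.Decidable using (decidable-stable; ¬?; map′; _×-dec_; _⊎-dec_)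
open import Relation.Unary using (Decidable)

module _ {A : Set} where

  last-∷ʳ : ∀ xs {y : A} → last (xs ∷ʳ y) ≡ just y
  last-∷ʳ []            = refl
  last-∷ʳ (x ∷ [])      = refl
  last-∷ʳ (x ∷ x′ ∷ xs) = last-∷ʳ (x′ ∷ xs)

  last-reverse : ∀ (xs : List A) → last (reverse xs) ≡ head xs
  last-reverse []       = refl
  last-reverse (x ∷ xs) rewrite unfold-reverse x xs = last-∷ʳ (reverse xs)

  head-reverse : ∀ (xs : List A) → head (reverse xs) ≡ last xs
  head-reverse xs = trans (sym (last-reverse (reverse xs))) (cong last (reverse-involutive xs))

  last-++-∷ : ∀ xs {y : A} ys → last (xs ++ y ∷ ys) ≡ last (y ∷ ys)
  last-++-∷ []            ys = refl
  last-++-∷ (x ∷ [])      ys = refl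
  last-++-∷ (x ∷ x′ ∷ xs) ys = last-++-∷ (x′ ∷ xs) ys

  head-∷ʳ : ∀ xs {c : A} ws → head (xs ∷ʳ c) ≡ head (xs ++ c ∷ ws)
  head-∷ʳ []      ws = refl
  head-∷ʳ (x ∷ _) ws = refl

  last-nonempty : ∀ (x : A) xs → ∃ λ b → last (x ∷ xs) ≡ just b
  last-nonempty x []       = x , refl
  last-nonempty x (y ∷ xs) = last-nonempty y xs

  last-∈ : ∀ xs {z : A} → last xs ≡ just z → z ∈ xs
  last-∈ (x ∷ [])     refl = here refl
  last-∈ (x ∷ y ∷ xs) eq   = there (last-∈ (y ∷ xs) eq)

  last≡just⇒≢[] : ∀ {xs} {c : A} → last xs ≡ just c → xs ≢ []
  last≡just⇒≢[] () refl

  ∈⇒prefix : ∀ {s} {c : A} → c ∈ s → ∃₂ λ B r → s ≡ B ++ r × head B ≡ head s × last B ≡ just c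
  ∈⇒prefix {c = c} c∈s with zs , ws , refl ← ∈-∃++ c∈s =
    zs ∷ʳ c , ws , sym (++-assoc zs [ c ] ws) , head-∷ʳ zs ws , last-∷ʳ zs

  first-common : (∀ (a b : A) → Dec (a ≡ b)) → ∀ xs s {b} → b ∈ xs → b ∈ s →
    ∃ λ A₁ → ∃₂ λ w A′ → xs ≡ A₁ ++ w ∷ A′ × All (_∉ s) A₁ × w ∈ s
  first-common _≟_ xs s b∈xs b∈s
    with First._++_∷_ A₁∉s w∈s A′ ←
           First.toView (First.¬All⇒First (λ v → ¬? (any? (v ≟_) s)) (decidable-stable (any? (_ ≟_) s))
                                          (λ all∉s → All.lookup all∉s b∈xs b∈s)) =
    _ , _ , A′ , refl , A₁∉s , w∈s

  Unique-++⁻ˡ : ∀ xs {ys : List A} → Unique (xs ++ ys) → Unique xs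
  Unique-++⁻ˡ []       _        = []
  Unique-++⁻ˡ (x ∷ xs) (px ∷ u) = All.++⁻ˡ xs px ∷ Unique-++⁻ˡ xs u

  Unique-++⁻ʳ : ∀ xs {ys : List A} → Unique (xs ++ ys) → Unique ys
  Unique-++⁻ʳ []       u       = u
  Unique-++⁻ʳ (x ∷ xs) (_ ∷ u) = Unique-++⁻ʳ xs u

  Unique-++-disjoint : ∀ xs {ys} {v : A} → Unique (xs ++ ys) → v ∈ xs → v ∉ ys
  Unique-++-disjoint (x ∷ xs) (x∉ ∷ _) (here refl)  v∈ys = All.lookup (All.++⁻ʳ xs x∉) v∈ys refl
  Unique-++-disjoint (x ∷ xs) (_ ∷ u)  (there v∈xs) v∈ys = Unique-++-disjoint xs u v∈xs v∈ys

  Unique-reverse : ∀ {xs : List A} → Unique xs → Unique (reverse xs)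
  Unique-reverse {xs} = Perm.Unique-resp-↭ (setoid A) (Perm.↭-sym (setoid A) (Perm.↭-reverse (setoid A) xs))

module _ {A : Set} {R : A → A → Set} where

  Linked-++⁻ˡ : ∀ xs {ys} → Linked R (xs ++ ys) → Linked R xs
  Linked-++⁻ˡ []           _        = []
  Linked-++⁻ˡ (x ∷ [])     _        = [-]
  Linked-++⁻ˡ (x ∷ y ∷ xs) (r ∷ rs) = r ∷ Linked-++⁻ˡ (y ∷ xs) rs

  Linked-++⁻ʳ : ∀ xs {ys} → Linked R (xs ++ ys) → Linked R ys
  Linked-++⁻ʳ []       rs = rs
  Linked-++⁻ʳ (x ∷ xs) rs = Linked-++⁻ʳ xs (Linked.tail rs)

  Linked-glue : ∀ xs {w zs} → Linked R (xs ∷ʳ w) → Linked R (w ∷ zs) → Linked R (xs ++ w ∷ zs)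
  Linked-glue []           _        rs′ = rs′
  Linked-glue (x ∷ [])     (r ∷ _)  rs′ = r ∷ rs′
  Linked-glue (x ∷ y ∷ xs) (r ∷ rs) rs′ = r ∷ Linked-glue (y ∷ xs) rs rs′

  Linked-reverse : Symmetric R → ∀ {xs} → Linked R xs → Linked R (reverse xs)
  Linked-reverse R-sym {[]}     _  = []
  Linked-reverse R-sym {x ∷ xs} rs = subst (Linked R) (sym (unfold-reverse x xs))
    (Linked.++⁺ (Linked-reverse R-sym (Linked.tail rs)) junction [-])
    where
    junction : Connected R (last (reverse xs)) (just x)
    junction = subst (λ z → Connected R z (just x)) (sym (last-reverse xs))
                     (Connected.sym R-sym (Linked.head′ rs))

module _ {A : Set} where

  Consecutive : A → A → List A → Set
  Consecutive x y p = ∃₂ λ xs ys → p ≡ xs ++ x ∷ y ∷ ys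

  Consecutive-∷ : ∀ {x y} z {p} → Consecutive x y p → Consecutive x y (z ∷ p)
  Consecutive-∷ z (xs , ys , refl) = z ∷ xs , ys , refl

  Consecutive-infix : ∀ {x y} pre {q} r → Consecutive x y q → Consecutive x y (pre ++ q ++ r)
  Consecutive-infix {x} {y} pre r (xs , ys , refl) = pre ++ xs , ys ++ r , (begin
      pre ++ (xs ++ x ∷ y ∷ ys) ++ r ≡⟨ cong (pre ++_) (++-assoc xs (x ∷ y ∷ ys) r) ⟩
      pre ++ xs ++ x ∷ y ∷ ys ++ r   ≡⟨ ++-assoc pre xs _ ⟨
      (pre ++ xs) ++ x ∷ y ∷ ys ++ r ∎)
    where open ≡-Reasoning

  Consecutive-reverse : ∀ {x y} p → Consecutive x y p → Consecutive y x (reverse p)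
  Consecutive-reverse {x} {y} p (xs , ys , refl) = reverse ys , reverse xs , (begin
      reverse (xs ++ x ∷ y ∷ ys)               ≡⟨ reverse-++ xs (x ∷ y ∷ ys) ⟩
      reverse (x ∷ y ∷ ys) ++ reverse xs       ≡⟨ cong (_++ reverse xs) (reverse-++ (x ∷ y ∷ []) ys) ⟩
      (reverse ys ++ y ∷ x ∷ []) ++ reverse xs ≡⟨ ++-assoc (reverse ys) (y ∷ x ∷ []) (reverse xs) ⟩
      reverse ys ++ y ∷ x ∷ reverse xs         ∎)
    where open ≡-Reasoning

  Consecutive-∈ : ∀ {x y p} → Consecutive x y p → x ∈ p × y ∈ p
  Consecutive-∈ (xs , ys , refl) = ∈-++⁺ʳ xs (here refl) , ∈-++⁺ʳ xs (there (here refl))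

  consecutive? : (∀ (a b : A) → Dec (a ≡ b)) → ∀ x y p → Dec (Consecutive x y p)
  consecutive? _≟_ x y []          = no λ { ([] , _ , ()) ; (_ ∷ _ , _ , ()) }
  consecutive? _≟_ x y (a ∷ [])    = no λ { ([] , _ , ()) ; (_ ∷ [] , _ , ()) ; (_ ∷ _ ∷ _ , _ , ()) }
  consecutive? _≟_ x y (a ∷ b ∷ p) =
    map′ introduce eliminate ((a ≟ x ×-dec b ≟ y) ⊎-dec consecutive? _≟_ x y (b ∷ p))
    where
    introduce : (a ≡ x × b ≡ y) ⊎ Consecutive x y (b ∷ p) → Consecutive x y (a ∷ b ∷ p)
    introduce (inj₁ (refl , refl)) = [] , p , refl
    introduce (inj₂ c)             = Consecutive-∷ a c
    eliminate : Consecutive x y (a ∷ b ∷ p) → (a ≡ x × b ≡ y) ⊎ Consecutive x y (b ∷ p)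
    eliminate ([] , _ , refl)    = inj₁ (refl , refl)
    eliminate (_ ∷ xs , ys , eq) = inj₂ (xs , ys , ∷-injectiveʳ eq)

  edgeAt : List A → ℕ → Maybe (A × A)
  edgeAt (x ∷ y ∷ p) zero    = just (x , y)
  edgeAt (x ∷ y ∷ p) (suc i) = edgeAt (y ∷ p) i
  edgeAt _           _       = nothing

  edgeAt-∷ : ∀ x p i → edgeAt (x ∷ p) (suc i) ≡ edgeAt p i
  edgeAt-∷ x []      i = refl
  edgeAt-∷ x (y ∷ p) i = refl

  Consecutive⇒edgeAt : ∀ {x y} p → Consecutive x y p → ∃ λ i → edgeAt p i ≡ just (x , y)
  Consecutive⇒edgeAt p ([] , ys , refl) = zero , refl
  Consecutive⇒edgeAt {x} {y} p (z ∷ xs , ys , refl) with i , eq ← Consecutive⇒edgeAt _ (xs , ys , refl) =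
    suc i , trans (edgeAt-∷ z (xs ++ x ∷ y ∷ ys) i) eq

  edgeAt⇒Consecutive : ∀ {x y} p i → edgeAt p i ≡ just (x , y) → Consecutive x y p
  edgeAt⇒Consecutive (x ∷ y ∷ p) zero    refl = [] , p , refl
  edgeAt⇒Consecutive (z ∷ y ∷ p) (suc i) eq   = Consecutive-∷ z (edgeAt⇒Consecutive (y ∷ p) i eq)

  edgeAt-≤ : ∀ p {k e} j → edgeAt p k ≡ just e → j ≤ k → ∃ λ e′ → edgeAt p j ≡ just e′
  edgeAt-≤ (x ∷ y ∷ p) zero    _  _                   = (x , y) , refl
  edgeAt-≤ (x ∷ y ∷ p) {suc k} (suc j) eq (s≤s j≤k) = edgeAt-≤ (y ∷ p) j eq j≤k

  EdgeAt : List A → ℕ → A → A → Set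
  EdgeAt Q j x y = edgeAt Q j ≡ just (x , y) ⊎ edgeAt Q j ≡ just (y , x)

  edgeAt-position : ∀ Q {x y} → Consecutive x y Q ⊎ Consecutive y x Q → ∃ λ j → EdgeAt Q j x y
  edgeAt-position Q (inj₁ c) = Product.map₂ inj₁ (Consecutive⇒edgeAt Q c)
  edgeAt-position Q (inj₂ c) = Product.map₂ inj₂ (Consecutive⇒edgeAt Q c)

  At : List A → (A → A → Set) → ℕ → Set
  At Q S j = ∃₂ λ x y → edgeAt Q j ≡ just (x , y) × S x y

  module _ {S : A → A → Set} (S-sym : ∀ {x y} → S x y → S y x) where

    At-intro : ∀ Q {j x y} → EdgeAt Q j x y → S x y → At Q S j
    At-intro _ (inj₁ e) s = _ , _ , e , s
    At-intro _ (inj₂ e) s = _ , _ , e , S-sym s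

    At-elim : ∀ Q {j x y} → At Q S j → EdgeAt Q j x y → S x y
    At-elim _ (_ , _ , e′ , s) (inj₁ e) with refl ← trans (sym e′) e = s
    At-elim _ (_ , _ , e′ , s) (inj₂ e) with refl ← trans (sym e′) e = S-sym s

  prefix-through : ∀ Q k {c′ c} → edgeAt Q k ≡ just (c′ , c) →
    ∃₂ λ B r → Q ≡ B ++ r × last B ≡ just c × (∀ {j} → j ≤ k → edgeAt B j ≡ edgeAt Q j)
  prefix-through (x ∷ y ∷ r) zero    refl = x ∷ y ∷ [] , r , refl , refl , λ { z≤n → refl }
  prefix-through (x ∷ y ∷ r) (suc k) eq
    with y ∷ B , r′ , refl , last-B , agree ← prefix-through (y ∷ r) k eq =
    x ∷ y ∷ B , r′ , refl , last-B , λ { z≤n → refl ; (s≤s j≤k) → agree j≤k }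

  infix-spanning : ∀ Q {i j k a a′ c′ c x y} → i ≤ j → j ≤ k →
    edgeAt Q i ≡ just (a , a′) → edgeAt Q k ≡ just (c′ , c) → edgeAt Q j ≡ just (x , y) →
    ∃ λ pre → ∃₂ λ B r → Q ≡ pre ++ B ++ r × head B ≡ just a × last B ≡ just c × Consecutive x y B
  infix-spanning Q@(_ ∷ _ ∷ _) {zero} {j} {k} _ j≤k refl ek ej
    with b ∷ B , r , eq , last-B , agree ← prefix-through Q k ek =
    [] , b ∷ B , r , eq , cong head (sym eq) , last-B , edgeAt⇒Consecutive (b ∷ B) j (trans (agree j≤k) ej)
  infix-spanning (z ∷ Q) {suc i} {suc j} {suc k} (s≤s i≤j) (s≤s j≤k) ei ek ej
    with pre , B , r , eq , rest ← infix-spanning Q i≤j j≤k (trans (sym (edgeAt-∷ z Q i)) ei)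
                                     (trans (sym (edgeAt-∷ z Q k)) ek) (trans (sym (edgeAt-∷ z Q j)) ej) =
    z ∷ pre , B , r , cong (z ∷_) eq , rest

-- Convex sets of edge positions

Convex : (ℕ → Set) → Set
Convex R = ∀ {i j k} → i ≤ j → j ≤ k → R i → R k → R j

module _ {A : Set} where

  EdgePositions : List A → (ℕ → Set) → Set
  EdgePositions Q R = ∀ {j} → R j → ∃ λ e → edgeAt Q j ≡ just e

  Spans : (ℕ → Set) → List A → List A → Set
  Spans R Q q = ∀ {x y} → Consecutive x y q ⇔ (∃ λ j → R j × edgeAt Q j ≡ just (x , y))

  -- The recursive calls are made outside the case analysis on R? so that termination is evident.
  convex⇒prefix : ∀ Q {R} → Decidable R → Convex R → EdgePositions Q R → R 0 →
    ∃₂ λ q r → Q ≡ q ++ r × q ≢ [] × Spans R Q q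
  convex⇒prefix []       R? convex pos R0 with () ← proj₂ (pos R0)
  convex⇒prefix (x ∷ []) R? convex pos R0 with () ← proj₂ (pos R0)
  convex⇒prefix (x ∷ y ∷ r) {R} R? convex pos R0 =
    extend (R? 1) (convex⇒prefix (y ∷ r) (R? ∘ suc) (λ i≤j j≤k → convex (s≤s i≤j) (s≤s j≤k))
                                 (λ {j} → pos {suc j}))
    where
    Found : ℕ → A → A → Set
    Found j x′ y′ = R j × edgeAt (x ∷ y ∷ r) j ≡ just (x′ , y′)

    extend : Dec (R 1) → (R 1 → ∃₂ λ q r′ → y ∷ r ≡ q ++ r′ × q ≢ [] × Spans (R ∘ suc) (y ∷ r) q) →
             ∃₂ λ q r′ → x ∷ y ∷ r ≡ q ++ r′ × q ≢ [] × Spans R (x ∷ y ∷ r) q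
    extend (no ¬R1) _ = x ∷ y ∷ [] , r , refl , (λ ()) , mk⇔ to from
      where
      to : ∀ {x′ y′} → Consecutive x′ y′ (x ∷ y ∷ []) → ∃ λ j → Found j x′ y′
      to c with Consecutive⇒edgeAt _ c
      ... | zero  , refl = 0 , R0 , refl
      ... | suc _ , ()
      from : ∀ {x′ y′} → (∃ λ j → Found j x′ y′) → Consecutive x′ y′ (x ∷ y ∷ [])
      from (zero  , _  , refl) = [] , [] , refl
      from (suc j , Rj , _)    = ⊥-elim (¬R1 (convex z≤n (s≤s z≤n) R0 Rj))
    extend (yes R1) tail-prefix with tail-prefix R1
    ... | []    , _  , _    , q≢[] , _     = ⊥-elim (q≢[] refl)
    ... | y ∷ q , r′ , refl , _    , spans = x ∷ y ∷ q , r′ , refl , (λ ()) , mk⇔ to from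
      where
      to : ∀ {x′ y′} → Consecutive x′ y′ (x ∷ y ∷ q) → ∃ λ j → Found j x′ y′
      to ([] , _ , refl)    = 0 , R0 , refl
      to (_ ∷ xs , ys , eq) with j , Rj , ej ← Equivalence.to spans (xs , ys , ∷-injectiveʳ eq) =
        suc j , Rj , ej
      from : ∀ {x′ y′} → (∃ λ j → Found j x′ y′) → Consecutive x′ y′ (x ∷ y ∷ q)
      from (zero  , _  , refl) = [] , q , refl
      from (suc j , Rj , ej)   = Consecutive-∷ x (Equivalence.from spans (j , Rj , ej))

  convex⇒infix : ∀ Q {R} → Decidable R → Convex R → EdgePositions Q R → ∀ {i} → R i →
    ∃ λ pre → ∃₂ λ q r → Q ≡ pre ++ q ++ r × q ≢ [] × Spans R Q q
  convex⇒infix Q       R? convex pos {zero}  R0 = [] , convex⇒prefix Q R? convex pos R0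
  convex⇒infix []      R? convex pos {suc i} Ri with () ← proj₂ (pos Ri)
  convex⇒infix (x ∷ Q) {R} R? convex pos {suc i} Ri =
    shift (R? 0) (convex⇒infix Q (R? ∘ suc) (λ i≤j j≤k → convex (s≤s i≤j) (s≤s j≤k))
                               (λ {j} Rj → subst (λ e → ∃ λ e′ → e ≡ just e′) (edgeAt-∷ x Q j) (pos Rj)) Ri)
    where
    shift : Dec (R 0) → (∃ λ pre → ∃₂ λ q r → Q ≡ pre ++ q ++ r × q ≢ [] × Spans (R ∘ suc) Q q) →
            ∃ λ pre → ∃₂ λ q r → x ∷ Q ≡ pre ++ q ++ r × q ≢ [] × Spans R (x ∷ Q) q
    shift (yes R0) _ = [] , convex⇒prefix (x ∷ Q) R? convex pos R0
    shift (no ¬R0) (pre , q , r , eq , q≢[] , spans) = x ∷ pre , q , r , cong (x ∷_) eq , q≢[] , mk⇔ to from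
      where
      to : ∀ {x′ y′} → Consecutive x′ y′ q → ∃ λ j → R j × edgeAt (x ∷ Q) j ≡ just (x′ , y′)
      to c with j , Rj , ej ← Equivalence.to spans c = suc j , Rj , trans (edgeAt-∷ x Q j) ej
      from : ∀ {x′ y′} → (∃ λ j → R j × edgeAt (x ∷ Q) j ≡ just (x′ , y′)) → Consecutive x′ y′ q
      from (zero  , R0 , _)  = ⊥-elim (¬R0 R0)
      from (suc j , Rj , ej) = Equivalence.from spans (j , Rj , trans (sym (edgeAt-∷ x Q j)) ej)

module Paths {n : ℕ} (adj : Fin n → Fin n → Bool) where
  open GraphNotions adj

  _⊆ₑ_ : List (Fin n) → List (Fin n) → Set
  B ⊆ₑ p = ∀ {x y} → EdgeOf B x y → EdgeOf p x y

  EdgeOf-sym : ∀ {p x y} → EdgeOf p x y → EdgeOf p y x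
  EdgeOf-sym = Sum.swap

  EdgeOf-∈ : ∀ {p x y} → EdgeOf p x y → x ∈ p
  EdgeOf-∈ (inj₁ c) = proj₁ (Consecutive-∈ c)
  EdgeOf-∈ (inj₂ c) = proj₂ (Consecutive-∈ c)

  infix-⊆ₑ : ∀ pre {B} r → B ⊆ₑ (pre ++ B ++ r)
  infix-⊆ₑ pre r = Sum.map (Consecutive-infix pre r) (Consecutive-infix pre r)

  reverse-⊆ₑ : ∀ B → reverse B ⊆ₑ B
  reverse-⊆ₑ B = Sum.swap ∘ Sum.map back back
    where
    back : ∀ {x y} → Consecutive x y (reverse B) → Consecutive y x B
    back c = subst (Consecutive _ _) (reverse-involutive B) (Consecutive-reverse (reverse B) c)

  IsPath-infix : ∀ pre {B} r → IsPath (pre ++ B ++ r) → B ≢ [] → IsPath B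
  IsPath-infix pre {B} r (linked , unique , _) B≢[] =
    Linked-++⁻ˡ B (Linked-++⁻ʳ pre linked) , Unique-++⁻ˡ B (Unique-++⁻ʳ pre unique) , B≢[]

  IsPath-tail : ∀ {a x p} → IsPath (a ∷ x ∷ p) → IsPath (x ∷ p)
  IsPath-tail (linked , _ ∷ unique , _) = Linked.tail linked , unique , λ ()

  IsPath-reverse : Symmetric Adj → ∀ {p} → IsPath p → IsPath (reverse p)
  IsPath-reverse Adj-sym {[]}    (_ , _ , []≢[]) = ⊥-elim ([]≢[] refl)
  IsPath-reverse Adj-sym {x ∷ p} (linked , unique , _) =
    Linked-reverse Adj-sym linked , Unique-reverse unique ,
    λ eq → case ++-conicalʳ (reverse p) [ x ] (trans (sym (unfold-reverse x p)) eq) of λ ()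

  subpath-from : ∀ xs {a ys c} → IsPath (xs ++ a ∷ ys) → c ∈ a ∷ ys →
    ∃ λ B → PathFromTo a c B × B ⊆ₑ (xs ++ a ∷ ys)
  subpath-from xs path c∈ with B , r , eq , head-B , last-B ← ∈⇒prefix c∈ =
    B , (IsPath-infix xs r (subst (λ s → IsPath (xs ++ s)) eq path) (last≡just⇒≢[] last-B) , head-B , last-B) ,
    λ e → subst (λ s → EdgeOf (xs ++ s) _ _) (sym eq) (infix-⊆ₑ xs r e)

  subpath : Symmetric Adj → ∀ {p a c} → IsPath p → a ∈ p → c ∈ p → ∃ λ B → PathFromTo a c B × B ⊆ₑ p
  subpath Adj-sym path a∈ c∈ with xs , ys , refl ← ∈-∃++ a∈ with ∈-++⁻ xs c∈
  ... | inj₂ c∈ays = subpath-from xs path c∈ays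
  ... | inj₁ c∈xs
    with xs₁ , xs₂ , refl ← ∈-∃++ c∈xs
    with B , (path-B , head-B , last-B) , B⊆ ←
           subpath-from xs₁ (subst IsPath (++-assoc xs₁ _ _) path) (∈-++⁺ʳ (_ ∷ xs₂) (here refl)) =
    reverse B , (IsPath-reverse Adj-sym path-B , trans (head-reverse B) last-B , trans (last-reverse B) head-B) ,
    λ e → subst (λ s → EdgeOf s _ _) (sym (++-assoc xs₁ _ _)) (B⊆ (reverse-⊆ₑ B e))

-- Paths in a tree

module Tree (I : TreeWithLinks) where
  open Notions I
  open Paths adj

  Adj-sym : Symmetric Adj
  Adj-sym {x} {y} = subst T (adj-sym x y)

  closing-edge : ∀ {a w} C → Linked Adj (a ∷ (C ∷ʳ w)) → ∃ λ b → head (C ∷ʳ w) ≡ just b × Adj b a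
  closing-edge []      (r ∷ _) = _ , refl , Adj-sym r
  closing-edge (c ∷ _) (r ∷ _) = c , refl , Adj-sym r

  three-vertices : ∀ (a w : Vertex) A₁ C → A₁ ≢ [] ⊎ C ≢ [] → 3 ≤ length (a ∷ A₁ ++ w ∷ reverse C)
  three-vertices a w (_ ∷ A₁) C _ = s≤s (s≤s (nonempty A₁))
    where
    nonempty : ∀ xs → 1 ≤ length (xs ++ w ∷ reverse C)
    nonempty []      = s≤s z≤n
    nonempty (_ ∷ _) = s≤s z≤n
  three-vertices a w [] [] (inj₁ []≢[]) = ⊥-elim ([]≢[] refl)
  three-vertices a w [] [] (inj₂ []≢[]) = ⊥-elim ([]≢[] refl)
  three-vertices a w [] (c ∷ C) _ = s≤s (s≤s (subst (1 ≤_) (sym (length-reverse (c ∷ C))) (s≤s z≤n)))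

  branches-cycle : ∀ {a w} A₁ C → IsPath (a ∷ (A₁ ∷ʳ w)) → IsPath (a ∷ (C ∷ʳ w)) →
    (∀ {v} → v ∈ A₁ → v ∉ C) → A₁ ≢ [] ⊎ C ≢ [] → IsCycle (a ∷ A₁ ++ w ∷ reverse C)
  branches-cycle {a} {w} A₁ C (linked₁ , unique₁ , _) (linked₂ , unique₂ , _) A₁∉C nontrivial
    with b , head-b , b-a ← closing-edge C linked₂ =
    (linked , unique , λ ()) , three-vertices a w A₁ C nontrivial , a , b , refl , trans last-cycle head-b , b-a
    where
    back : w ∷ reverse C ≡ reverse (C ∷ʳ w)
    back = sym (reverse-++ C [ w ])

    linked : Linked Adj (a ∷ A₁ ++ w ∷ reverse C)
    linked = Linked-glue (a ∷ A₁) linked₁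
               (subst (Linked Adj) (sym back) (Linked-reverse Adj-sym (Linked.tail linked₂)))

    disjoint : ∀ {v} → v ∈ a ∷ (A₁ ∷ʳ w) → v ∉ reverse C
    disjoint v∈ v∈rC with v∈C ← Any.reverse⁻ {xs = C} v∈rC | v∈
    ... | here refl = Unique-++-disjoint [ a ] unique₂ (here refl) (∈-++⁺ˡ {ys = [ w ]} v∈C)
    ... | there v∈A₁w with ∈-++⁻ A₁ v∈A₁w
    ...   | inj₁ v∈A₁        = A₁∉C v∈A₁ v∈C
    ...   | inj₂ (here refl) = Unique-++-disjoint C (Unique-++⁻ʳ [ a ] unique₂) v∈C (here refl)

    unique : Unique (a ∷ A₁ ++ w ∷ reverse C)
    unique = subst Unique (cong (a ∷_) (++-assoc A₁ [ w ] (reverse C)))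
               (Unique.++⁺ unique₁ (Unique-reverse (Unique-++⁻ˡ C (Unique-++⁻ʳ [ a ] unique₂)))
                           (λ (v∈ , v∈rC) → disjoint v∈ v∈rC))

    last-cycle : last (a ∷ A₁ ++ w ∷ reverse C) ≡ head (C ∷ʳ w)
    last-cycle = begin
      last (a ∷ A₁ ++ w ∷ reverse C) ≡⟨ last-++-∷ (a ∷ A₁) (reverse C) ⟩
      last (w ∷ reverse C)           ≡⟨ cong last back ⟩
      last (reverse (C ∷ʳ w))        ≡⟨ last-reverse (C ∷ʳ w) ⟩
      head (C ∷ʳ w)                  ∎
      where open ≡-Reasoning

  -- Follow the first branch until it first meets the second one, at w; together with the
  -- second branch up to w this closes a cycle.
  no-two-branches : ∀ {a x y p q} → IsPath (a ∷ x ∷ p) → IsPath (a ∷ y ∷ q) → x ≢ y →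
    last (x ∷ p) ≡ last (y ∷ q) → ⊥
  no-two-branches {a} {x} {y} {p} {q} path₁ path₂ x≢y same-end
    with b , last-b ← last-nonempty x p
    with A₁ , w , A′ , eq₁ , A₁∉yq , w∈yq ←
           first-common Fin._≟_ (x ∷ p) (y ∷ q) (last-∈ (x ∷ p) last-b)
                        (last-∈ (y ∷ q) (trans (sym same-end) last-b))
    with C , C′ , eq₂ ← ∈-∃++ w∈yq =
    acyclic _ (branches-cycle A₁ C (prefix-path A₁ A′ eq₁ path₁) (prefix-path C C′ eq₂ path₂)
                              (λ v∈A₁ v∈C → All.lookup A₁∉yq v∈A₁ (subst (_ ∈_) (sym eq₂) (∈-++⁺ˡ v∈C)))
                              (nontrivial A₁ C eq₁ eq₂))
    where
    prefix-path : ∀ {s} B B′ → s ≡ B ++ w ∷ B′ → IsPath (a ∷ s) → IsPath (a ∷ (B ∷ʳ w))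
    prefix-path B B′ refl path =
      IsPath-infix [] B′ (subst (λ s → IsPath (a ∷ s)) (sym (++-assoc B [ w ] B′)) path) λ ()
    nontrivial : ∀ B C → x ∷ p ≡ B ++ w ∷ A′ → y ∷ q ≡ C ++ w ∷ C′ → B ≢ [] ⊎ C ≢ []
    nontrivial []      []      refl refl = ⊥-elim (x≢y refl)
    nontrivial (_ ∷ _) _       _    _    = inj₁ λ ()
    nontrivial []      (_ ∷ _) _    _    = inj₂ λ ()

  path-unique : ∀ {a b p q} → PathFromTo a b p → PathFromTo a b q → p ≡ q
  path-unique {p = []}    ((_ , _ , []≢[]) , _) _ = ⊥-elim ([]≢[] refl)
  path-unique {p = _ ∷ _} {[]} _ ((_ , _ , []≢[]) , _) = ⊥-elim ([]≢[] refl)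
  path-unique {a} {b} {a ∷ p} {a ∷ q} ends₁@(_ , refl , _) ends₂@(_ , refl , _) =
    cong (a ∷_) (same-tails p q ends₁ ends₂ (path-unique {p = p}))
    where
    same-tails : ∀ p q → PathFromTo a b (a ∷ p) → PathFromTo a b (a ∷ q) →
      (∀ {x q} → PathFromTo x b p → PathFromTo x b q → p ≡ q) → p ≡ q
    same-tails []      []      _ _ _ = refl
    same-tails []      (y ∷ q) (_ , _ , last₁) ((_ , a∉ ∷ _ , _) , _ , last₂) _ =
      ⊥-elim (All.lookup a∉ (last-∈ (y ∷ q) (trans last₂ (sym last₁))) refl)
    same-tails (x ∷ p) []      ((_ , a∉ ∷ _ , _) , _ , last₁) (_ , _ , last₂) _ =
      ⊥-elim (All.lookup a∉ (last-∈ (x ∷ p) (trans last₁ (sym last₂))) refl)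
    same-tails (x ∷ p) (y ∷ q) (path₁ , _ , last₁) (path₂ , _ , last₂) tails-unique with x Fin.≟ y
    ... | yes refl = tails-unique (IsPath-tail path₁ , refl , last₁) (IsPath-tail path₂ , refl , last₂)
    ... | no x≢y   = ⊥-elim (no-two-branches path₁ path₂ x≢y (trans last₁ (sym last₂)))

  path-within : ∀ {p a c B} → IsPath p → a ∈ p → c ∈ p → PathFromTo a c B → B ⊆ₑ p
  path-within {p} path a∈ c∈ B-path with B′ , B′-path , B′⊆p ← subpath Adj-sym path a∈ c∈ =
    subst (_⊆ₑ p) (path-unique B′-path B-path) B′⊆p

  Joins : Link → List Vertex → Set
  Joins ℓ = PathFromTo (proj₁ (ends ℓ)) (proj₂ (ends ℓ))

  path-of : Link → List Vertex
  path-of ℓ = proj₁ (connected (proj₁ (ends ℓ)) (proj₂ (ends ℓ)))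

  path-of-joins : ∀ ℓ → Joins ℓ (path-of ℓ)
  path-of-joins ℓ = proj₂ (connected (proj₁ (ends ℓ)) (proj₂ (ends ℓ)))

  P-sym : ∀ ℓ {x y} → P ℓ x y → P ℓ y x
  P-sym ℓ (p , joins , e) = p , joins , EdgeOf-sym e

  P⇒EdgeOf : ∀ {ℓ p x y} → Joins ℓ p → P ℓ x y → EdgeOf p x y
  P⇒EdgeOf {x = x} {y} joins (p′ , joins′ , e) = subst (λ s → EdgeOf s x y) (path-unique joins′ joins) e

  P? : ∀ ℓ x y → Dec (P ℓ x y)
  P? ℓ x y = map′ (λ e → path-of ℓ , path-of-joins ℓ , e) (P⇒EdgeOf (path-of-joins ℓ))
                  (consecutive? Fin._≟_ x y (path-of ℓ) ⊎-dec consecutive? Fin._≟_ y x (path-of ℓ))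

  P-convex : ∀ ℓ {Q} → IsPath Q → Convex (At Q (P ℓ))
  P-convex ℓ {Q} path-Q {j = j} i≤j j≤k (a , _ , ei , Pi) (_ , c , ek , Pk)
    with (x , y) , ej ← edgeAt-≤ Q j ek j≤k
    with pre , B , r , refl , head-B , last-B , xy∈B ← infix-spanning Q i≤j j≤k ei ek ej =
    x , y , ej , path-of ℓ , path-of-joins ℓ ,
    path-within (proj₁ (path-of-joins ℓ)) (EdgeOf-∈ (P⇒EdgeOf (path-of-joins ℓ) Pi))
                (EdgeOf-∈ (EdgeOf-sym (P⇒EdgeOf (path-of-joins ℓ) Pk)))
                (IsPath-infix pre r path-Q (last≡just⇒≢[] last-B) , head-B , last-B) (inj₁ xy∈B)

-- Private edges of a link in a minimal cover

module MinimalCover (I : TreeWithLinks) (F : Subset (TreeWithLinks.m I)) where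
  open Notions I
  open WithF F
  open Paths adj
  open Tree I

  module _ (u : Link) (Fu : Subset m) (covers : CoveredBy (P u) (_∈ₛ Fu))
           (minimal : ∀ S → S ⊂ Fu → ¬ CoveredBy (P u) (_∈ₛ S))
           (ℓ : Link) (ℓ∈Fu : ℓ ∈ₛ Fu) where

    not-redundant : ∀ {ℓ′} → ℓ′ ∈ₛ Fu →
      (∀ {x y} → P u x y → P ℓ′ x y → ∃ λ ℓ″ → ℓ″ ∈ₛ Fu × ℓ″ ≢ ℓ′ × P ℓ″ x y) → ⊥
    not-redundant {ℓ′} ℓ′∈Fu others = minimal (Fu - ℓ′) (x∈p⇒p-x⊂p ℓ′∈Fu) covers′
      where
      covers′ : CoveredBy (P u) (_∈ₛ Fu - ℓ′)
      covers′ x y Pu with ℓ″ , ℓ″∈Fu , Pℓ″ ← covers x y Pu with ℓ″ Fin.≟ ℓ′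
      ... | no ℓ″≢ℓ′ = ℓ″ , x∈p∧x≢y⇒x∈p-y ℓ″∈Fu ℓ″≢ℓ′ , Pℓ″
      ... | yes refl with ℓ‴ , ℓ‴∈Fu , ℓ‴≢ℓ′ , Pℓ‴ ← others Pu Pℓ″ =
        ℓ‴ , x∈p∧x≢y⇒x∈p-y ℓ‴∈Fu ℓ‴≢ℓ′ , Pℓ‴

    CoveredByOther : Vertex → Vertex → Set
    CoveredByOther x y = ∃ λ ℓ′ → ℓ′ ∈ₛ Fu × ℓ′ ≢ ℓ × P ℓ′ x y

    covered-by-other? : ∀ x y → Dec (CoveredByOther x y)
    covered-by-other? x y = Fin.any? λ ℓ′ → (ℓ′ ∈? Fu) ×-dec ¬? (ℓ′ Fin.≟ ℓ) ×-dec P? ℓ′ x y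

    Private : Vertex → Vertex → Set
    Private = Pul u Fu ℓ

    private⇔ : ∀ {x y} → Private x y ⇔ (P u x y × ¬ CoveredByOther x y)
    private⇔ = mk⇔ (λ (Pu , alone) → Pu , λ (ℓ′ , ℓ′∈Fu , ℓ′≢ℓ , Pℓ′) → alone ℓ′ ℓ′∈Fu ℓ′≢ℓ Pℓ′)
                   (λ (Pu , alone) → Pu , λ ℓ′ ℓ′∈Fu ℓ′≢ℓ Pℓ′ → alone (ℓ′ , ℓ′∈Fu , ℓ′≢ℓ , Pℓ′))

    private? : ∀ x y → Dec (Private x y)
    private? x y = map′ (Equivalence.from private⇔) (Equivalence.to private⇔)
                        (P? u x y ×-dec ¬? (covered-by-other? x y))

    Private-sym : ∀ {x y} → Private x y → Private y x
    Private-sym (Pu , alone) = P-sym u Pu , λ ℓ′ ℓ′∈Fu ℓ′≢ℓ Pℓ′ → alone ℓ′ ℓ′∈Fu ℓ′≢ℓ (P-sym ℓ′ Pℓ′)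

    private-nonempty : ∃₂ Private
    private-nonempty with Fin.any? (λ x → Fin.any? (private? x))
    ... | yes found = found
    ... | no none = ⊥-elim (not-redundant ℓ∈Fu other-cover)
      where
      other-cover : ∀ {x y} → P u x y → P ℓ x y → CoveredByOther x y
      other-cover {x} {y} Pu _ with covered-by-other? x y
      ... | yes other = other
      ... | no ¬other = ⊥-elim (none (x , y , Equivalence.from private⇔ (Pu , ¬other)))

    Q : List Vertex
    Q = path-of u

    Q-position : ∀ {x y} → P u x y → ∃ λ j → EdgeAt Q j x y
    Q-position Pu = edgeAt-position Q (P⇒EdgeOf (path-of-joins u) Pu)

    PrivateAt : ℕ → Set
    PrivateAt = At Q Private

    privateAt? : Decidable PrivateAt
    privateAt? j with edgeAt Q j
    ... | nothing      = no λ ()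
    ... | just (x , y) = map′ (λ priv → x , y , refl , priv) (λ { (_ , _ , refl , priv) → priv }) (private? x y)

    owner : ∀ {j} → PrivateAt j → At Q (P ℓ) j
    owner (x , y , e , Pu , alone) with ℓ′ , ℓ′∈Fu , Pℓ′ ← covers x y Pu with ℓ′ Fin.≟ ℓ
    ... | yes refl = x , y , e , Pℓ′
    ... | no ℓ′≢ℓ  = ⊥-elim (alone ℓ′ ℓ′∈Fu ℓ′≢ℓ Pℓ′)

    not-shared : ∀ {j ℓ′} → PrivateAt j → ℓ′ ∈ₛ Fu → ℓ′ ≢ ℓ → ¬ At Q (P ℓ′) j
    not-shared {ℓ′ = ℓ′} (x , y , e , _ , alone) ℓ′∈Fu ℓ′≢ℓ at =
      alone ℓ′ ℓ′∈Fu ℓ′≢ℓ (At-elim (P-sym ℓ′) Q at (inj₁ e))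

    private-convex : Convex PrivateAt
    private-convex {i} {j} {k} i≤j j≤k Ri Rk@(_ , _ , ek , _) with (x , y) , ej ← edgeAt-≤ Q j ek j≤k =
      x , y , ej , (Q , path-of-joins u , inj₁ (edgeAt⇒Consecutive Q j ej)) , alone
      where
      alone : ∀ ℓ′ → ℓ′ ∈ₛ Fu → ℓ′ ≢ ℓ → ¬ P ℓ′ x y
      alone ℓ′ ℓ′∈Fu ℓ′≢ℓ Pℓ′xy = not-redundant ℓ′∈Fu λ Pu Pℓ′ → ℓ , ℓ∈Fu , ℓ′≢ℓ ∘ sym , inside Pu Pℓ′
        where
        ℓ′-convex = P-convex ℓ′ (proj₁ (path-of-joins u))
        ℓ′-at-j : At Q (P ℓ′) j
        ℓ′-at-j = x , y , ej , Pℓ′xy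
        inside-at : ∀ {p} → At Q (P ℓ′) p → At Q (P ℓ) p
        inside-at {p} ℓ′-at-p with p ≤? i | k ≤? p
        ... | yes p≤i | _       = ⊥-elim (not-shared Ri ℓ′∈Fu ℓ′≢ℓ (ℓ′-convex p≤i i≤j ℓ′-at-p ℓ′-at-j))
        ... | no _    | yes k≤p = ⊥-elim (not-shared Rk ℓ′∈Fu ℓ′≢ℓ (ℓ′-convex j≤k k≤p ℓ′-at-j ℓ′-at-p))
        ... | no p≰i  | no k≰p  =
          P-convex ℓ (proj₁ (path-of-joins u)) (≰⇒≥ p≰i) (≰⇒≥ k≰p) (owner Ri) (owner Rk)
        inside : ∀ {x′ y′} → P u x′ y′ → P ℓ′ x′ y′ → P ℓ x′ y′
        inside Pu Pℓ′ with p , at ← Q-position Pu =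
          At-elim (P-sym ℓ) Q (inside-at (At-intro (P-sym ℓ′) Q at Pℓ′)) at

    private-path : ∃ λ q → IsPath q × (∀ x y → (EdgeOf q x y → Private x y) × (Private x y → EdgeOf q x y))
    private-path
      with x , y , priv ← private-nonempty
      with j , at ← Q-position (proj₁ priv)
      with pre , q , r , eq , q≢[] , spans ←
             convex⇒infix Q privateAt? private-convex (λ (x , y , e , _) → (x , y) , e)
                          (At-intro Private-sym Q at priv) =
      q , IsPath-infix pre r (subst IsPath eq (proj₁ (path-of-joins u))) q≢[] , λ x y → edge⇒private , private⇒edge
      where
      edge⇒private : ∀ {x y} → EdgeOf q x y → Private x y
      edge⇒private (inj₁ c) with j , Rj , ej ← Equivalence.to spans c = At-elim Private-sym Q Rj (inj₁ ej)
      edge⇒private (inj₂ c) with j , Rj , ej ← Equivalence.to spans c = At-elim Private-sym Q Rj (inj₂ ej)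
      private⇒edge : ∀ {x y} → Private x y → EdgeOf q x y
      private⇒edge priv with Q-position (proj₁ priv)
      ... | j , inj₁ ej = inj₁ (Equivalence.from spans (j , At-intro Private-sym Q (inj₁ ej) priv , ej))
      ... | j , inj₂ ej = inj₂ (Equivalence.from spans (j , At-intro Private-sym Q (inj₂ ej) priv , ej))

lemma6 : (I : TreeWithLinks) → let open Notions I in
    (F : Subset m) → CoversE F →
    let open WithF F in
    ∀ (u : Link) (t b : Vertex) → UpLinkWith u t b →
    ∀ (vu : Vertex) → IsVu u t vu →
    ∀ (Fu : Subset m) → IsFu u vu Fu →
    ∀ (ℓ : Link) → ℓ ∈ₛ Fu →
    (∃₂ λ x y → Pul u Fu ℓ x y) ×
    (∃ λ (q : List Vertex) → IsPath q ×
      (∀ x y → (EdgeOf q x y → Pul u Fu ℓ x y) × (Pul u Fu ℓ x y → EdgeOf q x y)))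
lemma6 I F _ u _ _ _ _ _ Fu (_ , covers , minimal) ℓ ℓ∈Fu =
  MinimalCover.private-nonempty I F u Fu covers minimal ℓ ℓ∈Fu ,
  MinimalCover.private-path I F u Fu covers minimal ℓ ℓ∈Fu
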